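{- Let $(\Sigma,\Gamma,\mathcal U)$ be a (pure) many-sorted finite model finding problem and let $f:A\to A$ be a function symbol of $\Sigma$. Enumerate $\mathcal U(A)$ as $a_1,\dots,a_m$ (distinct). Let $I$ be any interpretation of $(\Sigma,\Gamma,\mathcal U)$. Then there exists an interpretation $I'$ isomorphic to $I$ satisfying the ordered range constraints $\bigvee_{j=1}^{i+1} f(a_i)=a_j$ for each $i=1,\dots,m-1$, i.e. $I'(f)(a_i)\in\{a_1,\dots,a_{i+1}\}$ for $i=1,\dots,m-1$.
   Context: A signature $\Sigma$ consists of a finite set of sorts, a finite set of function symbols $g:A_1\times\dots\times A_n\to B$ (constants when $n=0$), and a finite set of predicate symbols $R:A_1\times\dots\times A_n\to\mathrm{Bool}$. A domain assignment $\mathcal U$ maps each sort to a nonempty finite set. A (pure) MSFMF problem is $(\Sigma,\Gamma,\mathcal U)$ with $\Gamma$ a finite set of many-sorted first-order formulas (with equality) over $\Sigma$ not mentioning domain elements. An interpretation $I$ assigns each function symbol $g:A_1\times\dots\times A_n\to B$ a function $\mathcal U(A_1)\times\dots\times\mathcal U(A_n)\to\mathcal U(B)$ and each predicate symbol a relation on the corresponding product of domains. A domain permutation $\sigma$ is a family of permutations $\sigma_\theta$ of $\mathcal U(\theta)$, one per sort; it acts by $(\sigma\bullet I)(g)(\sigma_{A_1}(a_1),\dots,\sigma_{A_n}(a_n))=\sigma_B(I(g)(a_1,\dots,a_n))$ and $(a_1,\dots,a_n)\in I(R)\iff(\sigma_{A_1}(a_1),\dots,\sigma_{A_n}(a_n))\in(\sigma\bullet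 I)(R)$. Interpretations $I,I'$ are isomorphic if $I'=\sigma\bullet I$ for some domain permutation $\sigma$. -}

module Defs where

open import Data.Nat using (ℕ; NonZero)
open import Data.Fin using (Fin)
open import Data.Bool using (Bool)
open import Data.Unit using (⊤; tt)
open import Data.Product using (_×_; _,_; Σ)
open import Data.List using (List; []; _∷_)
open import Data.List.Membership.Propositional using (_∈_)
open import Data.Fin.Permutation using (Permutation′; _⟨$⟩ʳ_)
open import Relation.Binary.PropositionalEquality using (_≡_; subst; sym)

record Signature : Set where
  field
    nSorts   : ℕ
    nFun     : ℕ
    funArgs  : Fin nFun → List (Fin nSorts)
    funRes   : Fin nFun → Fin nSorts
    nPred    : ℕ
    predArgs : Fin nPred → List (Fin nSorts)

module _ (Sig : Signature) where
  open Signature Sig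

  Sort : Set
  Sort = Fin nSorts

  mutual
    data Term (Ctx : List Sort) : Sort → Set where
      var : ∀ {s} → s ∈ Ctx → Term Ctx s
      app : (g : Fin nFun) → Terms Ctx (funArgs g) → Term Ctx (funRes g)

    data Terms (Ctx : List Sort) : List Sort → Set where
      []  : Terms Ctx []
      _∷_ : ∀ {s ss} → Term Ctx s → Terms Ctx ss → Terms Ctx (s ∷ ss)

  data Formula (Ctx : List Sort) : Set where
    ⊤f ⊥f  : Formula Ctx
    _≐_    : ∀ {s} → Term Ctx s → Term Ctx s → Formula Ctx
    relf   : (R : Fin nPred) → Terms Ctx (predArgs R) → Formula Ctx
    ¬f_    : Formula Ctx → Formula Ctx
    _∧f_ _∨f_ _⇒f_ : Formula Ctx → Formula Ctx → Formula Ctx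
    ∀f ∃f  : (s : Sort) → Formula (s ∷ Ctx) → Formula Ctx

  record DomainAssignment : Set where
    field
      size    : Sort → ℕ
      nonempty : (θ : Sort) → NonZero (size θ)

  record MSFMF : Set where
    field
      Γ : List (Formula [])
      U : DomainAssignment

  module _ (U : DomainAssignment) where
    open DomainAssignment U

    Dom : Sort → Set
    Dom θ = Fin (size θ)

    Args : List Sort → Set
    Args []       = ⊤
    Args (s ∷ ss) = Dom s × Args ss

    record Interpretation : Set where
      field
        fun : (g : Fin nFun) → Args (funArgs g) → Dom (funRes g)
        rel : (R : Fin nPred) → Args (predArgs R) → Bool

    DomainPermutation : Set
    DomainPermutation = (θ : Sort) → Permutation′ (size θ)

    mapArgs : DomainPermutation → (ss : List Sort) → Args ss → Args ss
    mapArgs σ []       _        = tt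
    mapArgs σ (s ∷ ss) (a , as) = (σ s ⟨$⟩ʳ a) , mapArgs σ ss as

    -- I' = σ • I  (stated pointwise, as in the definition of the action)
    _≡σ•_via_ : Interpretation → Interpretation → DomainPermutation → Set
    I' ≡σ• I via σ =
      ((g : Fin nFun) (as : Args (funArgs g)) →
         Interpretation.fun I' g (mapArgs σ (funArgs g) as)
           ≡ σ (funRes g) ⟨$⟩ʳ Interpretation.fun I g as)
      × ((R : Fin nPred) (as : Args (predArgs R)) →
         Interpretation.rel I R as
           ≡ Interpretation.rel I' R (mapArgs σ (predArgs R) as))

    Isomorphic : Interpretation → Interpretation → Set
    Isomorphic I I' = Σ DomainPermutation (λ σ → I' ≡σ• I via σ)

    apply1 : Interpretation → (f : Fin nFun) (A : Sort) →
             funArgs f ≡ A ∷ [] → funRes f ≡ A → Dom A → Dom A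
    apply1 I f A hA hR a =
      subst Dom hR (Interpretation.fun I f (subst Args (sym hA) (a , tt)))

-- Given g : Fin m → Fin m, walk through Fin m starting at 0: from the current
-- point x go to g x if it has not been visited yet, otherwise jump to some
-- unvisited point.  Visiting order enumerates Fin m, and in that enumeration
-- the k-th point is mapped by g to a point visited at step ≤ k + 1.  Renaming
-- the domain of f along this order (conjugated by the given enumeration) is a
-- domain permutation, and transporting I along it yields the required I'.
module Submission where

open import Data.Nat as ℕ using (ℕ; zero; suc; _≤_; _<_; s≤s)
import Data.Nat.Properties as ℕ
open import Data.Fin as Fin using (Fin; toℕ; fromℕ<; punchOut)
open import Data.Fin.Properties
  using (any?; _≟_; injective⇒≤; punchOut-injective; toℕ-injective; toℕ-fromℕ<; toℕ<n)
open import Data.Fin.Permutation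
  using (Permutation′; permutation; _⟨$⟩ʳ_; _⟨$⟩ˡ_; _∘ₚ_; flip; inverseˡ; inverseʳ)
import Data.Fin.Permutation as Perm
open import Data.List using (List; []; _∷_; length; lookup)
open import Data.List.Membership.Propositional using (_∈_; _∉_)
import Data.List.Membership.DecPropositional as DecMembership
open import Data.List.Relation.Unary.Any using (here; there; index)
open import Data.List.Relation.Unary.Any.Properties using (lookup-index)
open import Data.Product using (Σ; _×_; _,_; ∃; proj₁; proj₂)
open import Data.Sum using (_⊎_; inj₁; inj₂)
open import Data.Unit using (tt)
open import Function using (_∘_)
open import Function.Definitions using (Injective)
open import Relation.Binary.Definitions using (tri<; tri≈; tri>)
open import Relation.Binary.PropositionalEquality
open import Relation.Nullary using (yes; no; ¬?; contradiction)

open import Defs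

injective⇒surjective : ∀ {n} {f : Fin n → Fin n} →
                       Injective _≡_ _≡_ f → ∀ y → ∃ λ x → f x ≡ y
injective⇒surjective {suc n} {f} f-inj y with any? (λ x → f x ≟ y)
... | yes hit = hit
... | no miss = contradiction (injective⇒≤ punchOut∘f-injective) ℕ.1+n≰n
  where
  punchOut∘f : Fin (suc n) → Fin n
  punchOut∘f x = punchOut {i = y} (λ y≡fx → miss (x , sym y≡fx))

  punchOut∘f-injective : Injective _≡_ _≡_ punchOut∘f
  punchOut∘f-injective = f-inj ∘ punchOut-injective {i = y} _ _

injective⇒permutation : ∀ {n} (f : Fin n → Fin n) →
                        Injective _≡_ _≡_ f → Permutation′ n
injective⇒permutation f f-inj =
  permutation f (proj₁ ∘ surj) (proj₂ ∘ surj) (λ x → f-inj (proj₂ (surj (f x))))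
  where
  surj : ∀ y → ∃ λ x → f x ≡ y
  surj = injective⇒surjective f-inj

complete⇒≤length : ∀ {m} (L : List (Fin m)) → (∀ x → x ∈ L) → m ≤ length L
complete⇒≤length L complete = injective⇒≤ index-injective
  where
  index-injective : Injective _≡_ _≡_ (λ x → index (complete x))
  index-injective {x} {y} eq = begin
    x                             ≡⟨ lookup-index (complete x) ⟩
    lookup L (index (complete x)) ≡⟨ cong (lookup L) eq ⟩
    lookup L (index (complete y)) ≡⟨ lookup-index (complete y) ⟨
    y                             ∎
    where open ≡-Reasoning

conjugate : ∀ {n} → Permutation′ n → (Fin n → Fin n) → Fin n → Fin n
conjugate π h = (π ⟨$⟩ʳ_) ∘ h ∘ (π ⟨$⟩ˡ_)

conjugate-flip : ∀ {n} (π : Permutation′ n) (h : Fin n → Fin n) x →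
                 conjugate (flip π) (conjugate π h) x ≡ h x
conjugate-flip π h x rewrite inverseˡ π {x} = inverseˡ π

RangeOrdered : ∀ {n} → (Fin n → Fin n) → Set
RangeOrdered {n} h = ∀ i → suc (toℕ i) < n → toℕ (h i) ≤ suc (toℕ i)

module Walk {m} (g : Fin m → Fin m) (start : Fin m) where
  open DecMembership (_≟_ {m}) using (_∈?_)

  -- Falls back to start when L already contains every point; only used
  -- when length L < m.
  fresh : List (Fin m) → Fin m
  fresh L with any? (λ x → ¬? (x ∈? L))
  ... | yes (x , _) = x
  ... | no _ = start

  fresh-∉ : (L : List (Fin m)) → length L < m → fresh L ∉ L
  fresh-∉ L short with any? (λ x → ¬? (x ∈? L))
  ... | yes (_ , x∉L) = x∉L
  ... | no none = contradiction (complete⇒≤length L complete) (ℕ.<⇒≱ short)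
    where
    complete : ∀ x → x ∈ L
    complete x with x ∈? L
    ... | yes x∈L = x∈L
    ... | no x∉L = contradiction (x , x∉L) none

  step : Fin m → List (Fin m) → Fin m
  step x L with g x ∈? L
  ... | yes _ = fresh L
  ... | no _ = g x

  step-cases : ∀ x L → (g x ∉ L × step x L ≡ g x) ⊎ (g x ∈ L × step x L ≡ fresh L)
  step-cases x L with g x ∈? L
  ... | yes gx∈L = inj₂ (gx∈L , refl)
  ... | no gx∉L = inj₁ (gx∉L , refl)

  mutual
    walk : ℕ → Fin m
    walk zero = start
    walk (suc k) = step (walk k) (trail k)

    trail : ℕ → List (Fin m)
    trail zero = start ∷ []
    trail (suc k) = walk (suc k) ∷ trail k

  length-trail : ∀ k → length (trail k) ≡ suc k
  length-trail zero = refl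
  length-trail (suc k) = cong suc (length-trail k)

  ∈-trail⁻ : ∀ {x} k → x ∈ trail k → ∃ λ j → j ≤ k × walk j ≡ x
  ∈-trail⁻ zero (here refl) = zero , ℕ.≤-refl , refl
  ∈-trail⁻ (suc k) (here refl) = suc k , ℕ.≤-refl , refl
  ∈-trail⁻ (suc k) (there x∈trail) with ∈-trail⁻ k x∈trail
  ... | j , j≤k , walk-j = j , ℕ.m≤n⇒m≤1+n j≤k , walk-j

  ∈-trail⁺ : ∀ {j} k → j ≤ k → walk j ∈ trail k
  ∈-trail⁺ zero ℕ.z≤n = here refl
  ∈-trail⁺ {j} (suc k) j≤1+k with ℕ.m≤n⇒m<n∨m≡n j≤1+k
  ... | inj₁ (s≤s j≤k) = there (∈-trail⁺ k j≤k)
  ... | inj₂ refl = here refl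

  walk-∉-trail : ∀ k → suc k < m → walk (suc k) ∉ trail k
  walk-∉-trail k 2+k≤m with step-cases (walk k) (trail k)
  ... | inj₁ (gx∉L , eq) = subst (_∉ trail k) (sym eq) gx∉L
  ... | inj₂ (_ , eq) = subst (_∉ trail k) (sym eq)
          (fresh-∉ (trail k) (subst (_< m) (sym (length-trail k)) 2+k≤m))

  walk-g : ∀ k → ∃ λ j → j ≤ suc k × walk j ≡ g (walk k)
  walk-g k with step-cases (walk k) (trail k)
  ... | inj₁ (_ , eq) = suc k , ℕ.≤-refl , eq
  ... | inj₂ (gx∈L , _) with ∈-trail⁻ k gx∈L
  ...   | j , j≤k , walk-j = j , ℕ.m≤n⇒m≤1+n j≤k , walk-j

  walk-<-≢ : ∀ {j k} → j < k → k < m → walk j ≢ walk k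
  walk-<-≢ {j} {suc k} (s≤s j≤k) 1+k<m eq =
    walk-∉-trail k 1+k<m (subst (_∈ trail k) eq (∈-trail⁺ k j≤k))

  order : Fin m → Fin m
  order i = walk (toℕ i)

  order-injective : Injective _≡_ _≡_ order
  order-injective {i} {j} eq with ℕ.<-cmp (toℕ i) (toℕ j)
  ... | tri< i<j _ _ = contradiction eq (walk-<-≢ i<j (toℕ<n j))
  ... | tri≈ _ i≡j _ = toℕ-injective i≡j
  ... | tri> _ _ j<i = contradiction (sym eq) (walk-<-≢ j<i (toℕ<n i))

  ranking : Permutation′ m
  ranking = flip (injective⇒permutation order order-injective)

  ranking-order : ∀ i → ranking ⟨$⟩ʳ order i ≡ i
  ranking-order i = inverseʳ ranking

  rangeOrdered : RangeOrdered (conjugate ranking g)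
  rangeOrdered i 2+i<m with walk-g (toℕ i)
  ... | j , j≤1+i , walk-j = begin
    toℕ (ranking ⟨$⟩ʳ g (order i)) ≡⟨ cong (toℕ ∘ (ranking ⟨$⟩ʳ_)) walk-j ⟨
    toℕ (ranking ⟨$⟩ʳ walk j)      ≡⟨ cong (toℕ ∘ (ranking ⟨$⟩ʳ_) ∘ walk) (toℕ-fromℕ< j<m) ⟨
    toℕ (ranking ⟨$⟩ʳ order jᶠ)    ≡⟨ cong toℕ (ranking-order jᶠ) ⟩
    toℕ jᶠ                         ≡⟨ toℕ-fromℕ< j<m ⟩
    j                              ≤⟨ j≤1+i ⟩
    suc (toℕ i)                    ∎
    where
    open ℕ.≤-Reasoning
    j<m : j < m
    j<m = ℕ.≤-<-trans j≤1+i 2+i<m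
    jᶠ : Fin m
    jᶠ = fromℕ< j<m

ordered-conjugate : ∀ {m} (g : Fin m → Fin m) →
                    Σ (Permutation′ m) λ τ → RangeOrdered (conjugate τ g)
ordered-conjugate {zero} g = Perm.id , λ ()
ordered-conjugate {suc m} g = Walk.ranking g Fin.zero , Walk.rangeOrdered g Fin.zero

module _ (Sig : Signature) (U : DomainAssignment Sig) where
  open Signature Sig
  open Interpretation

  invert : DomainPermutation Sig U → DomainPermutation Sig U
  invert σ θ = flip (σ θ)

  mapArgs-invert : ∀ σ ss as → mapArgs Sig U (invert σ) ss (mapArgs Sig U σ ss as) ≡ as
  mapArgs-invert σ [] tt = refl
  mapArgs-invert σ (s ∷ ss) (a , as) = cong₂ _,_ (inverseˡ (σ s)) (mapArgs-invert σ ss as)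

  transport : DomainPermutation Sig U → Interpretation Sig U → Interpretation Sig U
  transport σ I = record
    { fun = λ g as → σ (funRes g) ⟨$⟩ʳ fun I g (mapArgs Sig U (invert σ) (funArgs g) as)
    ; rel = λ R as → rel I R (mapArgs Sig U (invert σ) (predArgs R) as)
    }

  transport-isomorphic : ∀ σ I → Isomorphic Sig U I (transport σ I)
  transport-isomorphic σ I =
    σ , (λ g as → cong (λ bs → σ (funRes g) ⟨$⟩ʳ fun I g bs) (mapArgs-invert σ _ as))
      , (λ R as → cong (rel I R) (sym (mapArgs-invert σ _ as)))

  apply1-transport : ∀ σ I f A hA hR x →
    apply1 Sig U (transport σ I) f A hA hR x ≡ conjugate (σ A) (apply1 Sig U I f A hA hR) x
  apply1-transport σ I f A hA hR x = along hA hR (fun I f)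
    where
    along : ∀ {ss s} (hA : ss ≡ A ∷ []) (hR : s ≡ A) (F : Args Sig U ss → Dom Sig U s) →
      subst (Dom Sig U) hR (σ s ⟨$⟩ʳ F (mapArgs Sig U (invert σ) ss (subst (Args Sig U) (sym hA) (x , tt))))
        ≡ σ A ⟨$⟩ʳ subst (Dom Sig U) hR (F (subst (Args Sig U) (sym hA) (σ A ⟨$⟩ˡ x , tt)))
    along refl refl F = refl

  onlyAt : (A : Sort Sig) → Permutation′ (DomainAssignment.size U A) → DomainPermutation Sig U
  onlyAt A π θ with θ ≟ A
  ... | yes refl = π
  ... | no _ = Perm.id

  onlyAt-self : ∀ A π → onlyAt A π A ≡ π
  onlyAt-self A π rewrite ≡-≟-identity _≟_ (refl {x = A}) = refl

mainTheorem4 : (Sig : Signature) (P : MSFMF Sig)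
    → let U = MSFMF.U P
          m = DomainAssignment.size U
      in (f : Fin (Signature.nFun Sig)) (A : Sort Sig)
         (hA : Signature.funArgs Sig f ≡ A ∷ []) (hR : Signature.funRes Sig f ≡ A)
         (enum : Permutation′ (m A))
         (I : Interpretation Sig U)
    → Σ (Interpretation Sig U) λ I' →
        Isomorphic Sig U I I'
        × ((i : Fin (m A)) → suc (toℕ i) < m A →
             toℕ (enum ⟨$⟩ˡ apply1 Sig U I' f A hA hR (enum ⟨$⟩ʳ i)) ≤ suc (toℕ i))
mainTheorem4 Sig P f A hA hR enum I = I' , transport-isomorphic Sig U σ I , ordered
  where
  U : DomainAssignment Sig
  U = MSFMF.U P

  F : Dom Sig U A → Dom Sig U A
  F = apply1 Sig U I f A hA hR

  τ : Permutation′ (DomainAssignment.size U A)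
  τ = proj₁ (ordered-conjugate (conjugate (flip enum) F))

  σ : DomainPermutation Sig U
  σ = onlyAt Sig U A (flip enum ∘ₚ τ ∘ₚ enum)

  I' : Interpretation Sig U
  I' = transport Sig U σ I

  renamed : ∀ i → conjugate (flip enum) (apply1 Sig U I' f A hA hR) i
                ≡ conjugate τ (conjugate (flip enum) F) i
  renamed i = begin
    enum ⟨$⟩ˡ apply1 Sig U I' f A hA hR (enum ⟨$⟩ʳ i)
      ≡⟨ cong (enum ⟨$⟩ˡ_) (apply1-transport Sig U σ I f A hA hR (enum ⟨$⟩ʳ i)) ⟩
    conjugate (flip enum) (conjugate (σ A) F) i
      ≡⟨ cong (λ π → conjugate (flip enum) (conjugate π F) i) (onlyAt-self Sig U A _) ⟩
    conjugate (flip enum) (conjugate enum (conjugate τ (conjugate (flip enum) F))) i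
      ≡⟨ conjugate-flip enum (conjugate τ (conjugate (flip enum) F)) i ⟩
    conjugate τ (conjugate (flip enum) F) i ∎
    where open ≡-Reasoning

  ordered : RangeOrdered (conjugate (flip enum) (apply1 Sig U I' f A hA hR))
  ordered i 2+i<m = subst (λ k → toℕ k ≤ suc (toℕ i)) (sym (renamed i))
    (proj₂ (ordered-conjugate (conjugate (flip enum) F)) i 2+i<m)
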